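{- For $k\ge 1$ and $m\ge 3$, the graph $P_{2k}\,\square\, C_m$ (Cartesian product of the path on $2k$ vertices and the cycle on $m$ vertices) is a ${\cal D}$ graph for the Maker-Breaker total domination game.
   Context: All graphs are finite and simple. The Maker-Breaker total domination game on a graph $G$ is played by Dominator and Staller, who alternately select a vertex of $G$ not selected before. Dominator wins if at some point the set of vertices he has selected is a total dominating set of $G$ (every vertex has a neighbour in it); otherwise Staller wins. A graph is ${\cal D}$ if Dominator has a winning strategy both when he moves first and when Staller moves first. -}

module Defs where

open import Data.Nat using (ℕ; zero; suc; _+_; _*_)
open import Data.Fin using (Fin; toℕ)
open import Data.Fin.Properties using (_≟_)
open import Data.Product using (Σ; _×_; _,_; ∃)
open import Data.Sum using (_⊎_)
open import Data.List using (List; []; _∷_)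
open import Data.List.Membership.Propositional using (_∈_; _∉_)
open import Data.List.Relation.Unary.Any using (Any)
open import Relation.Nullary using (¬_)
open import Relation.Binary.PropositionalEquality using (_≡_)

-- A graph: vertex type and adjacency relation (only instantiated below with
-- the finite simple graph P_a □ C_m).
record Graph : Set₁ where
  field
    V      : Set
    Adj    : V → V → Set
open Graph public

TotallyDominates : (G : Graph) → List (V G) → Set
TotallyDominates G D = ∀ v → Σ (V G) λ u → (u ∈ D) × Adj G v u

Free : (G : Graph) → List (V G) → List (V G) → V G → Set
Free G D S v = (v ∉ D) × (v ∉ S)

-- Maker-Breaker total domination game positions: D = Dominator's vertices,
-- S = Staller's vertices. WinD: Dominator to move and has a winning strategy;
-- WinS: Staller to move and Dominator has a winning strategy.
-- Dominator wins as soon as D is a total dominating set; if the board is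
-- exhausted before that, Staller wins (a player to move with no free vertex
-- means the game is over).
mutual
  data WinD (G : Graph) (D S : List (V G)) : Set where
    doneD : TotallyDominates G D → WinD G D S
    moveD : (v : V G) → Free G D S v → WinS G (v ∷ D) S → WinD G D S

  data WinS (G : Graph) (D S : List (V G)) : Set where
    doneS : TotallyDominates G D → WinS G D S
    moveS : (Σ (V G) λ v → Free G D S v) →
            ((v : V G) → Free G D S v → WinD G D (v ∷ S)) →
            WinS G D S

-- G is a 𝒟 graph: Dominator wins both the D-game and the S-game.
IsD : Graph → Set
IsD G = WinD G [] [] × WinS G [] []

PathAdj : ∀ {a} → Fin a → Fin a → Set
PathAdj i j = (suc (toℕ i) ≡ toℕ j) ⊎ (suc (toℕ j) ≡ toℕ i)

-- Cycle C_m: vertices 0..m-1, i ~ j iff |i - j| = 1 or {i, j} = {0, m-1}.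
-- (Simple for m ≥ 3.)
CycAdj : ∀ {m} → Fin m → Fin m → Set
CycAdj {m} i j = PathAdj i j
  ⊎ ((toℕ i ≡ 0) × (suc (toℕ j) ≡ m))
  ⊎ ((toℕ j ≡ 0) × (suc (toℕ i) ≡ m))

PathBoxCycle : ℕ → ℕ → Graph
PathBoxCycle a m = record
  { V   = Fin a × Fin m
  ; Adj = λ { (x , y) (x' , y') →
              ((x ≡ x') × CycAdj y y') ⊎ ((y ≡ y') × PathAdj x x') } }

-- Dominator plays a pairing strategy. Pair the rows of P_2k as {2i, 2i+1} and,
-- inside each pair of rows, pair the vertices along diagonals:
-- (2i, j+1) with (2i+1, j), indices of C_m taken mod m. The neighbourhood of
-- every vertex contains a whole diagonal: (2i, j) sees {(2i, j+1), (2i+1, j)}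
-- and (2i+1, j) sees {(2i, j), (2i+1, j-1)}. Whenever Staller claims a vertex,
-- Dominator claims its partner (or any free vertex if the partner is already
-- his); then at the end of the game Dominator owns a vertex of every diagonal,
-- hence a total dominating set, whoever starts.
module Submission where

open import Defs
open import Data.Nat using (ℕ; _≤_; _*_)
open import Data.Nat as ℕ using (zero; suc; _<_; z≤n; s≤s)
open import Data.Nat.Properties using (suc-injective; *-suc)
open import Data.Fin using (Fin; zero; suc; toℕ; fromℕ; fromℕ<; inject₁; lower₁)
open import Data.Fin.Properties as Finₚ
  using (toℕ-fromℕ; toℕ-fromℕ<; toℕ<n; toℕ-injective; toℕ-inject₁; toℕ-inject₁-≢;
         toℕ-lower₁; inject₁-lower₁; lower₁-inject₁′)
open import Data.Bool using (Bool; true; false; not; if_then_else_)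
open import Data.Product using (∃; _,_; proj₁; proj₂)
open import Data.Product.Properties using (≡-dec)
open import Data.Sum using (_⊎_; inj₁; inj₂)
open import Data.List using (List; _∷_; allFin; cartesianProduct)
open import Data.List.Membership.Propositional using (_∈_; _∉_; lose)
open import Data.List.Membership.Propositional.Properties
  using (∈-allFin; ∈-cartesianProduct⁺)
open import Data.List.Relation.Unary.Any using (here; there; any?; satisfied)
open import Function using (_∘_)
open import Relation.Nullary using (¬_; Dec; yes; no; contradiction)
open import Relation.Nullary.Decidable using (_×-dec_; ¬?; map′)
open import Relation.Binary.Definitions using (DecidableEquality)
open import Relation.Binary.PropositionalEquality
  using (_≡_; _≢_; refl; sym; trans; cong; cong₂; subst; module ≡-Reasoning)
open import Relation.Binary.PropositionalEquality.Properties using (decSetoid)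
open ≡-Reasoning

module PairingStrategy
  (G : Graph) (_≟_ : DecidableEquality (V G))
  (vertices : List (V G)) (∈-vertices : ∀ v → v ∈ vertices)
  (partner : V G → V G)
  (partner-involutive : ∀ v → partner (partner v) ≡ v)
  (partner-≢ : ∀ v → partner v ≢ v)
  (witness : V G → V G)
  (witness-adj : ∀ v → Adj G v (witness v))
  (partner-witness-adj : ∀ v → Adj G v (partner (witness v)))
  where

  open import Data.List.Countdown (decSetoid _≟_) using (_⊕_; emptyFromList; lookup!; insert)
  open import Data.List.Membership.DecPropositional _≟_ using (_∈?_)

  Paired : List (V G) → List (V G) → Set
  Paired D S = ∀ {v} → v ∈ S → partner v ∈ D

  free? : ∀ D S v → Dec (Free G D S v)
  free? D S v = ¬? (v ∈? D) ×-dec ¬? (v ∈? S)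

  free-vertex? : ∀ D S → Dec (∃ (Free G D S))
  free-vertex? D S =
    map′ satisfied (λ (v , free) → lose (∈-vertices v) free) (any? (free? D S) vertices)

  exhausted⇒totallyDominates : ∀ {D S} → ¬ ∃ (Free G D S) → Paired D S → TotallyDominates G D
  exhausted⇒totallyDominates {D} {S} none paired v with witness v ∈? D | witness v ∈? S
  ... | yes w∈D | _       = witness v , w∈D , witness-adj v
  ... | no _    | yes w∈S = partner (witness v) , paired w∈S , partner-witness-adj v
  ... | no w∉D  | no w∉S  = contradiction (witness v , w∉D , w∉S) none

  -- Termination: counted ⊕ n bounds by n the vertices outside counted. Free
  -- vertices are kept uncounted, so each Staller move and each unprompted
  -- Dominator move can be inserted into the counter, decreasing n.
  FreeUncounted : List (V G) → List (V G) → List (V G) → Set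
  FreeUncounted D S counted = ∀ v → Free G D S v → v ∉ counted

  free-∷ˡ : ∀ {D S w v} → Free G (w ∷ D) S v → Free G D S v
  free-∷ˡ (v∉w∷D , v∉S) = v∉w∷D ∘ there , v∉S

  free-∷ʳ : ∀ {D S w v} → Free G D (w ∷ S) v → Free G D S v
  free-∷ʳ (v∉D , v∉w∷S) = v∉D , v∉w∷S ∘ there

  uncounted-∷ˡ : ∀ {D S counted w} →
                 FreeUncounted D S counted → FreeUncounted (w ∷ D) S (w ∷ counted)
  uncounted-∷ˡ uncounted v free (here v≡w)  = proj₁ free (here v≡w)
  uncounted-∷ˡ uncounted v free (there v∈c) = uncounted v (free-∷ˡ free) v∈c

  uncounted-∷ʳ : ∀ {D S counted w} →
                 FreeUncounted D S counted → FreeUncounted D (w ∷ S) (w ∷ counted)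
  uncounted-∷ʳ uncounted v free (here v≡w)  = proj₂ free (here v≡w)
  uncounted-∷ʳ uncounted v free (there v∈c) = uncounted v (free-∷ʳ free) v∈c

  mutual
    dominatorWins : ∀ {D S counted n} → counted ⊕ n → FreeUncounted D S counted →
                    Paired D S → WinD G D S
    dominatorWins {D} {S} counter uncounted paired with free-vertex? D S
    ... | no none          = doneD (exhausted⇒totallyDominates none paired)
    ... | yes (w , w-free) = dominatorClaims counter uncounted paired w w-free

    dominatorClaims : ∀ {D S counted n} → counted ⊕ n → FreeUncounted D S counted →
                      Paired D S → ∀ w → Free G D S w → WinD G D S
    dominatorClaims {n = zero} counter uncounted _ w w-free =
      contradiction (lookup! counter w) (uncounted w w-free)
    dominatorClaims {n = suc _} counter uncounted paired w w-free =
      moveD w w-free (stallerWins (insert counter w (uncounted w w-free))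
                                  (uncounted-∷ˡ uncounted) (there ∘ paired))

    stallerWins : ∀ {D S counted n} → counted ⊕ n → FreeUncounted D S counted →
                  Paired D S → WinS G D S
    stallerWins {D} {S} counter uncounted paired with free-vertex? D S
    ... | no none  = doneS (exhausted⇒totallyDominates none paired)
    ... | yes some = moveS some (dominatorAnswers counter uncounted paired)

    dominatorAnswers : ∀ {D S counted n} → counted ⊕ n → FreeUncounted D S counted →
                       Paired D S → ∀ v → Free G D S v → WinD G D (v ∷ S)
    dominatorAnswers {n = zero} counter uncounted _ v v-free =
      contradiction (lookup! counter v) (uncounted v v-free)
    dominatorAnswers {n = suc _} counter uncounted paired v v-free =
      dominatorReplies v v-free (insert counter v (uncounted v v-free))
                       (uncounted-∷ʳ uncounted) paired

    dominatorReplies : ∀ {D S counted n} v → Free G D S v → counted ⊕ n →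
                       FreeUncounted D (v ∷ S) counted → Paired D S → WinD G D (v ∷ S)
    dominatorReplies {D} {S} v v-free counter uncounted paired with partner v ∈? D
    ... | yes p∈D = dominatorWins counter uncounted paired′
      where
        paired′ : Paired D (v ∷ S)
        paired′ (here refl) = p∈D
        paired′ (there u∈S) = paired u∈S
    ... | no p∉D = moveD (partner v) (p∉D , p∉v∷S)
                     (stallerWins counter (λ u → uncounted u ∘ free-∷ˡ) paired′)
      where
        p∉v∷S : partner v ∉ v ∷ S
        p∉v∷S (here p≡v)  = partner-≢ v p≡v
        p∉v∷S (there p∈S) = proj₁ v-free (subst (_∈ D) (partner-involutive v) (paired p∈S))
        paired′ : Paired (partner v ∷ D) (v ∷ S)
        paired′ (here refl) = here refl
        paired′ (there u∈S) = there (paired u∈S)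

  isD : IsD G
  isD = dominatorWins counter (λ _ _ ()) (λ ()) , stallerWins counter (λ _ _ ()) (λ ())
    where counter = emptyFromList vertices ∈-vertices

next : ∀ {n} → Fin (suc n) → Fin (suc n)
next {n} j with n ℕ.≟ toℕ j
... | yes _   = zero
... | no n≢j  = suc (lower₁ j n≢j)

prev : ∀ {n} → Fin (suc n) → Fin (suc n)
prev {n} zero    = fromℕ n
prev     (suc i) = inject₁ i

prev-next : ∀ {n} (j : Fin (suc n)) → prev (next j) ≡ j
prev-next {n} j with n ℕ.≟ toℕ j
... | yes n≡j = toℕ-injective (trans (toℕ-fromℕ n) n≡j)
... | no n≢j  = inject₁-lower₁ j n≢j

next-prev : ∀ {n} (j : Fin (suc n)) → next (prev j) ≡ j
next-prev {n} zero with n ℕ.≟ toℕ (fromℕ n)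
... | yes _ = refl
... | no n≢ = contradiction (sym (toℕ-fromℕ n)) n≢
next-prev {n} (suc i) with n ℕ.≟ toℕ (inject₁ i)
... | yes n≡ = contradiction n≡ (toℕ-inject₁-≢ i)
... | no n≢  = cong suc (lower₁-inject₁′ i n≢)

next-adj : ∀ {n} (j : Fin (suc n)) → CycAdj j (next j)
next-adj {n} j with n ℕ.≟ toℕ j
... | yes n≡j = inj₂ (inj₂ (refl , cong suc (sym n≡j)))
... | no n≢j  = inj₁ (inj₁ (cong suc (sym (toℕ-lower₁ j n≢j))))

prev-adj : ∀ {n} (j : Fin (suc n)) → CycAdj j (prev j)
prev-adj {n} zero    = inj₂ (inj₁ (refl , cong suc (toℕ-fromℕ n)))
prev-adj     (suc i) = inj₁ (inj₂ (cong suc (toℕ-inject₁ i)))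

mate : ℕ → ℕ
mate 0             = 1
mate 1             = 0
mate (suc (suc n)) = suc (suc (mate n))

even : ℕ → Bool
even 0             = true
even 1             = false
even (suc (suc n)) = even n

mate-involutive : ∀ n → mate (mate n) ≡ n
mate-involutive 0             = refl
mate-involutive 1             = refl
mate-involutive (suc (suc n)) = cong (ℕ.suc ∘ ℕ.suc) (mate-involutive n)

mate-≢ : ∀ n → mate n ≢ n
mate-≢ 0             ()
mate-≢ 1             ()
mate-≢ (suc (suc n)) eq = mate-≢ n (suc-injective (suc-injective eq))

even-mate : ∀ n → even (mate n) ≡ not (even n)
even-mate 0             = refl
even-mate 1             = refl
even-mate (suc (suc n)) = even-mate n

mate-adjacent : ∀ n → suc n ≡ mate n ⊎ suc (mate n) ≡ n
mate-adjacent 0             = inj₁ refl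
mate-adjacent 1             = inj₂ refl
mate-adjacent (suc (suc n)) with mate-adjacent n
... | inj₁ eq = inj₁ (cong (ℕ.suc ∘ ℕ.suc) eq)
... | inj₂ eq = inj₂ (cong (ℕ.suc ∘ ℕ.suc) eq)

mate-< : ∀ k {n} → n < 2 * k → mate n < 2 * k
mate-< (suc k) {n} n<2k rewrite *-suc 2 k = go n n<2k
  where
    go : ∀ n → n < suc (suc (2 * k)) → mate n < suc (suc (2 * k))
    go 0             _                 = s≤s (s≤s z≤n)
    go 1             _                 = s≤s z≤n
    go (suc (suc n)) (s≤s (s≤s n<2k)) = s≤s (s≤s (mate-< k n<2k))

module Rows (k : ℕ) where

  mateFin : Fin (2 * k) → Fin (2 * k)
  mateFin x = fromℕ< (mate-< k (toℕ<n x))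

  toℕ-mateFin : ∀ x → toℕ (mateFin x) ≡ mate (toℕ x)
  toℕ-mateFin x = toℕ-fromℕ< (mate-< k (toℕ<n x))

  mateFin-involutive : ∀ x → mateFin (mateFin x) ≡ x
  mateFin-involutive x = toℕ-injective (begin
    toℕ (mateFin (mateFin x)) ≡⟨ toℕ-mateFin (mateFin x) ⟩
    mate (toℕ (mateFin x))    ≡⟨ cong mate (toℕ-mateFin x) ⟩
    mate (mate (toℕ x))       ≡⟨ mate-involutive (toℕ x) ⟩
    toℕ x                     ∎)

  mateFin-≢ : ∀ x → mateFin x ≢ x
  mateFin-≢ x eq = mate-≢ (toℕ x) (trans (sym (toℕ-mateFin x)) (cong toℕ eq))

  even-mateFin : ∀ x → even (toℕ (mateFin x)) ≡ not (even (toℕ x))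
  even-mateFin x = trans (cong even (toℕ-mateFin x)) (even-mate (toℕ x))

  mateFin-adj : ∀ x → PathAdj x (mateFin x)
  mateFin-adj x rewrite toℕ-mateFin x = mate-adjacent (toℕ x)

module Diagonals (k n : ℕ) where
  open Rows k

  G : Graph
  G = PathBoxCycle (2 * k) (suc n)

  shift : Bool → Fin (suc n) → Fin (suc n)
  shift b = if b then prev else next

  shift-not : ∀ b j → shift (not b) (shift b j) ≡ j
  shift-not true  j = next-prev j
  shift-not false j = prev-next j

  partner : V G → V G
  partner (x , j) = mateFin x , shift (even (toℕ x)) j

  witness : V G → V G
  witness (x , j) = if even (toℕ x) then (x , next j) else (mateFin x , j)

  partner-involutive : ∀ v → partner (partner v) ≡ v
  partner-involutive (x , j) rewrite even-mateFin x =
    cong₂ _,_ (mateFin-involutive x) (shift-not (even (toℕ x)) j)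

  partner-≢ : ∀ v → partner v ≢ v
  partner-≢ (x , _) = mateFin-≢ x ∘ cong proj₁

  witness-adj : ∀ v → Adj G v (witness v)
  witness-adj (x , j) with even (toℕ x)
  ... | true  = inj₁ (refl , next-adj j)
  ... | false = inj₂ (refl , mateFin-adj x)

  partner-witness-adj : ∀ v → Adj G v (partner (witness v))
  partner-witness-adj (x , j) with even (toℕ x) in x-even
  ... | true  rewrite x-even | prev-next j = inj₂ (refl , mateFin-adj x)
  ... | false rewrite even-mateFin x | x-even | mateFin-involutive x = inj₁ (refl , prev-adj j)

  vertices : List (V G)
  vertices = cartesianProduct (allFin (2 * k)) (allFin (suc n))

  ∈-vertices : ∀ v → v ∈ vertices
  ∈-vertices (x , j) = ∈-cartesianProduct⁺ (∈-allFin x) (∈-allFin j)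

  isD : IsD G
  isD = PairingStrategy.isD G (≡-dec Finₚ._≟_ Finₚ._≟_) vertices ∈-vertices
          partner partner-involutive partner-≢ witness witness-adj partner-witness-adj

theorem4p3 : (k m : ℕ) → 1 ≤ k → 3 ≤ m → IsD (PathBoxCycle (2 * k) m)
theorem4p3 k zero    _ ()
theorem4p3 k (suc n) _ _  = Diagonals.isD k n
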